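{- Let $\mathcal{N}$ be a (possibly infinite) near hexagon with exactly three points on each line, and let $\mathcal{H}$ be a full proper subgeometry of $\mathcal{N}$ isomorphic to $H^D(2)$ and isometrically embedded in $\mathcal{N}$. Then: (1) every point of $\mathcal{N}$ has distance at most $1$ from $\mathcal{H}$; (2) every point $x$ of $\mathcal{H}$ has Type A, and the valuation $f_x$ is the classical valuation with center $x$; (3) every point $y$ at distance $1$ from $\mathcal{H}$ has Type C and is collinear with a unique point $y'$ of $\mathcal{H}$; moreover $\mathcal{O}_{f_y}=\{y'\}$.
   Context: A near hexagon is a partial linear space whose collinearity graph is connected of diameter $3$ such that for every point $x$ and line $L$ there is a unique point on $L$ nearest to $x$. $\mathcal{H}$ full means every point of $\mathcal{N}$ on a line of $\mathcal{H}$ lies in $\mathcal{H}$; isometrically embedded means distances in $\mathcal{H}$ equal those in $\mathcal{N}$. $H^D(2)$ is the point-line dual of the split Cayley hexagon of order $2$. A valuation of $\mathcal{H}$ is a map $f$ from the point set of $\mathcal{H}$ to $\mathbb{Z}$ with minimum value $0$ such that each line has a unique point of minimal $f$-value and its other points have $f$-value one larger; $M_f$ is its maximum and $\mathcal{O}_f=f^{ -1}(0)$. The classical valuation with center $p$ is $y\mapsto \mathrm{d}(y,p)$. For a point $x$ of $\mathcal{N}$, $f_x(y)=\mathrm{d}(x,y)-\mathrm{d}(x,\mathcal{H})$ for points $y$ of $\mathcal{H}$; it is a valuation of $\mathcal{H}$, and the type of $x$ is the type of $f_x$. Type A valuations are the classical ones; Type C valuations are those $f$ with $M_f=2$ and $|\mathcal{O}_f|=1$.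 -}

module Defs where

open import Data.Nat using (ℕ; zero; suc; _≤_; _<_; _⊓_; _∸_)
open import Data.Fin using (Fin; toℕ) renaming (zero to fzero; suc to fsuc)
open import Data.Vec using (Vec; []; _∷_; lookup)
open import Data.Vec.Membership.Propositional using (_∈_)
open import Data.Product using (Σ; Σ-syntax; _×_)
open import Data.Sum using (_⊎_)
open import Relation.Binary.PropositionalEquality using (_≡_; _≢_)
open import Relation.Nullary using (¬_)
open import Function.Bundles using (_⇔_)
open import Function.Definitions using (Injective)

-- Walks in a graph given by an adjacency relation.
-- Walk adj x y n : there is a walk of length at most n from x to y.

data Walk {P : Set} (adj : P → P → Set) : P → P → ℕ → Set where
  here : ∀ {x n} → Walk adj x x n
  step : ∀ {x y z n} → adj x y → Walk adj y z n → Walk adj x z (suc n)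

-- Near hexagons (points and lines are arbitrary, possibly infinite, types).
-- d is the distance in the collinearity graph; it is uniquely determined
-- by the field d-spec (d x y ≤ n iff there is a walk of length ≤ n).

record NearHexagon : Set₁ where
  field
    Point : Set
    Line  : Set
    _on_  : Point → Line → Set
  Collinear : Point → Point → Set
  Collinear p q = p ≢ q × Σ[ L ∈ Line ] (p on L × q on L)
  field
    line-has-two-points : ∀ L → Σ[ p ∈ Point ] Σ[ q ∈ Point ] (p ≢ q × p on L × q on L)
    unique-line : ∀ {p q L M} → p ≢ q → p on L → q on L → p on M → q on M → L ≡ M
    -- distance in the collinearity graph (this also gives connectivity)
    d      : Point → Point → ℕ
    d-spec : ∀ x y n → (d x y ≤ n) ⇔ Walk Collinear x y n
    diam-≤3 : ∀ x y → d x y ≤ 3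
    diam-=3 : Σ[ x ∈ Point ] Σ[ y ∈ Point ] d x y ≡ 3
    nearest : ∀ x L → Σ[ p ∈ Point ] (p on L × (∀ q → q on L → q ≢ p → d x p < d x q))

ThreePointsPerLine : NearHexagon → Set
ThreePointsPerLine N =
  ∀ L → Σ[ a ∈ Point ] Σ[ b ∈ Point ] Σ[ c ∈ Point ]
          ( a ≢ b × a ≢ c × b ≢ c
          × a on L × b on L × c on L
          × (∀ p → p on L → p ≡ a ⊎ p ≡ b ⊎ p ≡ c))
  where open NearHexagon N

-- The generalized hexagon H^D(2): the point-line dual of the split Cayley
-- hexagon H(2).  Both points and lines are indexed by Fin 63; line l
-- consists of the three points listed in row l of hd2Table.
-- The table was generated as follows: H(2) was built from the split
-- octonions (Zorn vector matrices) over GF(2): points are the 63 nonzero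
-- trace-zero octonions x with N(x) = 0, lines are the 63 triples {x,y,x+y}
-- of such points with x·y = 0.  Points of H^D(2) = lines of H(2) (indexed
-- 0..62), lines of H^D(2) = points of H(2); row l lists the three lines of
-- H(2) through point l.  (Checked by computer: the result is a
-- generalized hexagon of order 2 whose points are NOT all distance-3-regular,
-- as opposed to H(2), so it is indeed H^D(2) and not H(2).)

hd2Table : Vec (Vec ℕ 3) 63
hd2Table =
    (0 ∷ 1 ∷ 2 ∷ []) ∷
    (3 ∷ 4 ∷ 5 ∷ []) ∷
    (6 ∷ 7 ∷ 8 ∷ []) ∷
    (9 ∷ 10 ∷ 11 ∷ []) ∷
    (12 ∷ 13 ∷ 14 ∷ []) ∷
    (15 ∷ 16 ∷ 17 ∷ []) ∷
    (18 ∷ 19 ∷ 20 ∷ []) ∷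
    (3 ∷ 9 ∷ 15 ∷ []) ∷
    (3 ∷ 21 ∷ 22 ∷ []) ∷
    (9 ∷ 23 ∷ 24 ∷ []) ∷
    (15 ∷ 25 ∷ 26 ∷ []) ∷
    (0 ∷ 10 ∷ 12 ∷ []) ∷
    (0 ∷ 27 ∷ 28 ∷ []) ∷
    (10 ∷ 29 ∷ 30 ∷ []) ∷
    (12 ∷ 31 ∷ 32 ∷ []) ∷
    (6 ∷ 11 ∷ 18 ∷ []) ∷
    (6 ∷ 33 ∷ 34 ∷ []) ∷
    (11 ∷ 35 ∷ 36 ∷ []) ∷
    (18 ∷ 37 ∷ 38 ∷ []) ∷
    (1 ∷ 4 ∷ 7 ∷ []) ∷
    (1 ∷ 39 ∷ 40 ∷ []) ∷
    (4 ∷ 41 ∷ 42 ∷ []) ∷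
    (7 ∷ 43 ∷ 44 ∷ []) ∷
    (5 ∷ 13 ∷ 19 ∷ []) ∷
    (5 ∷ 45 ∷ 46 ∷ []) ∷
    (13 ∷ 47 ∷ 48 ∷ []) ∷
    (19 ∷ 49 ∷ 50 ∷ []) ∷
    (2 ∷ 16 ∷ 20 ∷ []) ∷
    (2 ∷ 51 ∷ 52 ∷ []) ∷
    (16 ∷ 53 ∷ 54 ∷ []) ∷
    (20 ∷ 55 ∷ 56 ∷ []) ∷
    (8 ∷ 14 ∷ 17 ∷ []) ∷
    (8 ∷ 57 ∷ 58 ∷ []) ∷
    (14 ∷ 59 ∷ 60 ∷ []) ∷
    (17 ∷ 61 ∷ 62 ∷ []) ∷
    (29 ∷ 41 ∷ 53 ∷ []) ∷
    (35 ∷ 42 ∷ 61 ∷ []) ∷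
    (30 ∷ 45 ∷ 62 ∷ []) ∷
    (36 ∷ 46 ∷ 54 ∷ []) ∷
    (23 ∷ 39 ∷ 47 ∷ []) ∷
    (36 ∷ 40 ∷ 59 ∷ []) ∷
    (24 ∷ 51 ∷ 60 ∷ []) ∷
    (35 ∷ 48 ∷ 52 ∷ []) ∷
    (30 ∷ 43 ∷ 55 ∷ []) ∷
    (24 ∷ 44 ∷ 49 ∷ []) ∷
    (29 ∷ 50 ∷ 57 ∷ []) ∷
    (23 ∷ 56 ∷ 58 ∷ []) ∷
    (21 ∷ 27 ∷ 33 ∷ []) ∷
    (28 ∷ 46 ∷ 58 ∷ []) ∷
    (22 ∷ 52 ∷ 57 ∷ []) ∷
    (34 ∷ 45 ∷ 51 ∷ []) ∷
    (31 ∷ 42 ∷ 56 ∷ []) ∷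
    (37 ∷ 41 ∷ 60 ∷ []) ∷
    (22 ∷ 32 ∷ 38 ∷ []) ∷
    (21 ∷ 55 ∷ 59 ∷ []) ∷
    (25 ∷ 40 ∷ 50 ∷ []) ∷
    (38 ∷ 39 ∷ 62 ∷ []) ∷
    (26 ∷ 28 ∷ 37 ∷ []) ∷
    (27 ∷ 49 ∷ 61 ∷ []) ∷
    (32 ∷ 44 ∷ 54 ∷ []) ∷
    (26 ∷ 43 ∷ 48 ∷ []) ∷
    (25 ∷ 31 ∷ 34 ∷ []) ∷
    (33 ∷ 47 ∷ 53 ∷ []) ∷
    []

HPoint : Set
HPoint = Fin 63

HLine : Set
HLine = Fin 63

_onH_ : HPoint → HLine → Set
p onH l = toℕ p ∈ lookup hd2Table l

CollinearH : HPoint → HPoint → Set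
CollinearH p q = p ≢ q × Σ[ l ∈ HLine ] (p onH l × q onH l)

WalkH : HPoint → HPoint → ℕ → Set
WalkH = Walk CollinearH

record HD2Sub (N : NearHexagon) : Set where
  open NearHexagon N
  field
    ι     : HPoint → Point
    ιL    : HLine → Line
    ι-inj  : Injective _≡_ _≡_ ι
    ιL-inj : Injective _≡_ _≡_ ιL
    incidence : ∀ p l → (p onH l) ⇔ (ι p on ιL l)

module _ (N : NearHexagon) (H : HD2Sub N) where
  open NearHexagon N
  open HD2Sub H

  Full : Set
  Full = ∀ l x → x on ιL l → Σ[ p ∈ HPoint ] ι p ≡ x

  Proper : Set
  Proper = ¬ ((∀ x → Σ[ p ∈ HPoint ] ι p ≡ x) × (∀ L → Σ[ l ∈ HLine ] ιL l ≡ L))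

  Isometric : Set
  Isometric = ∀ p q n → (d (ι p) (ι q) ≤ n) ⇔ WalkH p q n

minFin : ∀ {n} → (Fin (suc n) → ℕ) → ℕ
minFin {zero}  f = f fzero
minFin {suc n} f = f fzero ⊓ minFin (λ i → f (fsuc i))

module _ (N : NearHexagon) (H : HD2Sub N) where
  open NearHexagon N
  open HD2Sub H

  distToH : Point → ℕ
  distToH x = minFin (λ p → d x (ι p))

  fval : Point → HPoint → ℕ
  fval x y = d x (ι y) ∸ distToH x

-- Valuations of H^D(2) (ℕ-valued: a ℤ-valued map with minimum 0 is the
-- same thing).

IsValuation : (HPoint → ℕ) → Set
IsValuation f =
  Σ[ p ∈ HPoint ] f p ≡ 0
  × (∀ l → Σ[ p ∈ HPoint ] (p onH l × (∀ q → q onH l → q ≢ p → f q ≡ suc (f p))))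

-- f is the classical valuation with center c, i.e. f y = d_H(c, y)
-- (d_H(c,y) ≤ n iff there is a walk of length ≤ n in H^D(2))
Classical : (HPoint → ℕ) → HPoint → Set
Classical f c = ∀ y n → (f y ≤ n) ⇔ WalkH c y n

TypeA : (HPoint → ℕ) → Set
TypeA f = Σ[ c ∈ HPoint ] Classical f c

MaxIs2 : (HPoint → ℕ) → Set
MaxIs2 f = (∀ y → f y ≤ 2) × Σ[ y ∈ HPoint ] f y ≡ 2

ZeroSetIs : (HPoint → ℕ) → HPoint → Set
ZeroSetIs f c = ∀ y → (f y ≡ 0) ⇔ (y ≡ c)

TypeC : (HPoint → ℕ) → Set
TypeC f = IsValuation f × MaxIs2 f × Σ[ c ∈ HPoint ] ZeroSetIs f c

{-# OPTIONS --safe #-}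
module Submission where

-- For a point x of N, f_x is a valuation of H (by fullness and the nearest-point
-- axiom), and f_x ≤ 3 − d(x, H) because N has diameter 3.  An exhaustive search
-- over H^D(2) shows that every valuation with values at most 2 takes the value 2,
-- and has a single zero if its zeros are pairwise at distance at most 2.  The
-- first fact forces d(x, H) ≤ 1.  If d(y, H) = 1, the zeros of f_y are the points
-- of H collinear with y, pairwise at distance 2 through y, so there is exactly
-- one.  For x in H, f_x = d(x, ·), which is classical as H is isometrically embedded.

open import Defs
open import Data.Bool using (Bool; true; false; T; _∧_; _∨_; not; if_then_else_)
open import Data.Bool.Properties using (T-≡; T-∧; T-∨; T-not-≡)
open import Data.Bool.ListAction using (all; any)
open import Data.Empty using (⊥-elim)
open import Data.Fin using (Fin; toℕ; zero; suc)
open import Data.Fin.Properties using (toℕ-injective; toℕ<n; toℕ-fromℕ<)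
open import Data.List as List using (List; []; _∷_; upTo; applyUpTo; filterᵇ; length)
open import Data.List.Membership.Propositional using (find) renaming (_∈_ to _∈ₗ_)
open import Data.List.Membership.Propositional.Properties
  using (∈-filter⁺; ∈-filter⁻; ∈-tabulate⁺; ∈-upTo⁺; ∈-upTo⁻)
open import Data.List.Relation.Unary.All as All using (All; []; _∷_; all?)
open import Data.List.Relation.Unary.All.Properties using (all⁺; all⁻; filter⁺; tabulate⁺)
import Data.List.Relation.Unary.Any as Anyₗ
open import Data.List.Relation.Unary.Any.Properties using (any⁺; any⁻)
open import Data.Maybe using (Maybe; just; nothing; is-just)
open import Data.Nat
  using (ℕ; zero; suc; _≤_; _<_; _∸_; _≡ᵇ_; _≤ᵇ_; _<?_; _≤?_; _≟_; z≤n; s≤s; NonZero)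
open import Data.Nat.DivMod using (_mod_; m<n⇒m%n≡m)
open import Data.Nat.Properties
  using (≡ᵇ⇒≡; ≡⇒≡ᵇ; ≤ᵇ⇒≤; ≤-refl; ≤-trans; ≤-antisym; ≤-pred; n≤1+n; 1+n≰n; ≰⇒>;
         n≤0⇒n≡0; n∸n≡0; 0≢1+n; +-∸-assoc; ∸-monoˡ-≤; ∸-monoʳ-≤; m∸n≡0⇒m≤n; m≤n⇒m∸n≡0;
         ⊓-sel; m⊓n≤m; m⊓n≤n)
open import Data.Product using (Σ-syntax; ∃-syntax; _×_; _,_; proj₁; proj₂)
open import Data.Sum using (inj₁; inj₂; [_,_]′)
open import Data.Unit using (tt)
open import Data.Vec using (Vec; []; _∷_; lookup; toList)
open import Data.Vec.Membership.Propositional using (_∈_)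
open import Data.Vec.Membership.Propositional.Properties using (∈-toList⁺)
open import Data.Vec.Relation.Unary.Any using (here; there)
open import Function using (_∘_)
open import Function.Bundles using (_⇔_; Equivalence; mk⇔)
open import Relation.Nullary using (yes; no)
open import Relation.Nullary.Decidable using (Dec; T?; ¬?; _×-dec_; from-yes)
open import Relation.Binary.PropositionalEquality
  using (_≡_; _≢_; refl; sym; trans; cong; subst; subst₂; ≢-sym)

data LineValues : ℕ → ℕ → ℕ → Set where
  minˡ : ∀ m → LineValues m (suc m) (suc m)
  minᵐ : ∀ m → LineValues (suc m) m (suc m)
  minʳ : ∀ m → LineValues (suc m) (suc m) m

lineValuesᵇ : ℕ → ℕ → ℕ → Bool
lineValuesᵇ (suc x) (suc y) (suc z) = lineValuesᵇ x y z
lineValuesᵇ 0 1 1 = true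
lineValuesᵇ 1 0 1 = true
lineValuesᵇ 1 1 0 = true
lineValuesᵇ _ _ _ = false

LineValues⇒lineValuesᵇ : ∀ {x y z} → LineValues x y z → T (lineValuesᵇ x y z)
LineValues⇒lineValuesᵇ (minˡ zero)    = tt
LineValues⇒lineValuesᵇ (minˡ (suc m)) = LineValues⇒lineValuesᵇ (minˡ m)
LineValues⇒lineValuesᵇ (minᵐ zero)    = tt
LineValues⇒lineValuesᵇ (minᵐ (suc m)) = LineValues⇒lineValuesᵇ (minᵐ m)
LineValues⇒lineValuesᵇ (minʳ zero)    = tt
LineValues⇒lineValuesᵇ (minʳ (suc m)) = LineValues⇒lineValuesᵇ (minʳ m)

module _ {A : Set} (f : A → ℕ) {x y z : A} (x≢y : x ≢ y) (x≢z : x ≢ z) (y≢z : y ≢ z) where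

  centre⇒LineValues : ∀ {c} → c ∈ x ∷ y ∷ z ∷ [] →
                      (∀ {q} → q ∈ x ∷ y ∷ z ∷ [] → q ≢ c → f q ≡ suc (f c)) →
                      LineValues (f x) (f y) (f z)
  centre⇒LineValues (here refl) above
    rewrite above (there (here refl)) (≢-sym x≢y) | above (there (there (here refl))) (≢-sym x≢z)
    = minˡ (f x)
  centre⇒LineValues (there (here refl)) above
    rewrite above (here refl) x≢y | above (there (there (here refl))) (≢-sym y≢z)
    = minᵐ (f y)
  centre⇒LineValues (there (there (here refl))) above
    rewrite above (here refl) x≢z | above (there (here refl)) y≢z
    = minʳ (f z)

-- Points are handled as their indices in hd2Table: Agda compares ℕ much faster than Fin 63.
Assignment : Set
Assignment = ℕ → Maybe ℕ

unassigned : Assignment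
unassigned _ = nothing

infixl 6 _[_↦_]
infix 4 _≼_

_[_↦_] : Assignment → ℕ → ℕ → Assignment
(ρ [ p ↦ v ]) q = if q ≡ᵇ p then just v else ρ q

_≼_ : Assignment → (ℕ → ℕ) → Set
ρ ≼ g = ∀ n {v} → ρ n ≡ just v → g n ≡ v

unassigned-≼ : ∀ {g} → unassigned ≼ g
unassigned-≼ _ ()

≼-assign : ∀ {ρ g} p → ρ ≼ g → ρ [ p ↦ g p ] ≼ g
≼-assign {ρ} {g} p ρ≼g n with n ≡ᵇ p in n≡ᵇp
... | true  = λ { refl → cong g (≡ᵇ⇒≡ n p (Equivalence.from T-≡ n≡ᵇp)) }
... | false = ρ≼g n

≼-just : ∀ {ρ g n} → ρ ≼ g → T (is-just (ρ n)) → ρ n ≡ just (g n)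
≼-just {ρ} {g} {n} ρ≼g assigned with ρ n in ρn
... | just _  = cong just (sym (ρ≼g n ρn))
... | nothing = ⊥-elim assigned

LineValuesOn : (ℕ → ℕ) → Vec ℕ 3 → Set
LineValuesOn g (a ∷ b ∷ c ∷ []) = LineValues (g a) (g b) (g c)

partialLineValuesᵇ : Maybe ℕ → Maybe ℕ → Maybe ℕ → Bool
partialLineValuesᵇ (just x) (just y) (just z) = lineValuesᵇ x y z
partialLineValuesᵇ _        _        _        = true

admits : Assignment → Vec ℕ 3 → Bool
admits ρ (a ∷ b ∷ c ∷ []) = partialLineValuesᵇ (ρ a) (ρ b) (ρ c)

admits-≼ : ∀ {ρ g t} → ρ ≼ g → LineValuesOn g t → T (admits ρ t)
admits-≼ {ρ} {g} {a ∷ b ∷ c ∷ []} ρ≼g lv with ρ a in ρa | ρ b in ρb | ρ c in ρc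
... | just _  | just _  | just _  = known (ρ≼g a ρa) (ρ≼g b ρb) (ρ≼g c ρc)
  where
  known : ∀ {x y z} → g a ≡ x → g b ≡ y → g c ≡ z → T (lineValuesᵇ x y z)
  known refl refl refl = LineValues⇒lineValuesᵇ lv
... | nothing | _       | _       = tt
... | just _  | nothing | _       = tt
... | just _  | just _  | nothing = tt

T-if : ∀ {b x} → T b → T (if b then x else true) → T x
T-if {true} _ t = t

Schedule : Set
Schedule = List (ℕ × List (Vec ℕ 3))

mutual
  search : List ℕ → (Assignment → Bool) → Schedule → Assignment → Bool
  search values leaf []              ρ = leaf ρ
  search values leaf ((p , ts) ∷ s) ρ = all (λ v → descend values leaf ts s (ρ [ p ↦ v ])) values

  descend : List ℕ → (Assignment → Bool) → List (Vec ℕ 3) → Schedule → Assignment → Bool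
  descend values leaf ts s ρ = if all (admits ρ) ts then search values leaf s ρ else true

module _ (values : List ℕ) (leaf : Assignment → Bool)
         {g : ℕ → ℕ} (g∈values : ∀ n → g n ∈ₗ values) where

  -- The branch assigning g's values is never pruned, as g satisfies every line checked.
  search-sound : ∀ s {ρ} → ρ ≼ g → All (All (LineValuesOn g) ∘ proj₂) s →
                 search values leaf s ρ ≡ true → ∃[ σ ] (σ ≼ g × T (leaf σ))
  search-sound []              ρ≼g _             found = _ , ρ≼g , Equivalence.from T-≡ found
  search-sound ((p , ts) ∷ s) {ρ} ρ≼g (lvs ∷ s-lvs) found =
    search-sound s ρ′≼g s-lvs (Equivalence.to T-≡ (T-if admitted descended))
    where
    ρ′≼g : ρ [ p ↦ g p ] ≼ g
    ρ′≼g = ≼-assign p ρ≼g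
    admitted : T (all (admits (ρ [ p ↦ g p ])) ts)
    admitted = all⁻ _ (All.map (admits-≼ ρ′≼g) lvs)
    descended : T (descend values leaf ts s (ρ [ p ↦ g p ]))
    descended = All.lookup (all⁺ _ values (Equivalence.from T-≡ found)) (g∈values p)

∈-filterᵇ⁺ : ∀ {A : Set} (P : A → Bool) {x xs} → x ∈ₗ xs → T (P x) → x ∈ₗ filterᵇ P xs
∈-filterᵇ⁺ P = ∈-filter⁺ (T? ∘ P)

∈-filterᵇ⁻ : ∀ {A : Set} (P : A → Bool) {x xs} → x ∈ₗ filterᵇ P xs → x ∈ₗ xs × T (P x)
∈-filterᵇ⁻ P = ∈-filter⁻ (T? ∘ P)

∈⇒any : ∀ {A : Set} {P : A → Bool} {x xs} → x ∈ₗ xs → T (P x) → T (any P xs)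
∈⇒any x∈xs px = any⁺ _ (Anyₗ.map (λ { refl → px }) x∈xs)

∈-length≤1 : ∀ {A : Set} {xs : List A} {x y} → length xs ≤ 1 → x ∈ₗ xs → y ∈ₗ xs → x ≡ y
∈-length≤1 {xs = _ ∷ []}    _       (Anyₗ.here refl) (Anyₗ.here refl) = refl
∈-length≤1 {xs = _ ∷ _ ∷ _} (s≤s ())

_∈ᵇ_ : ℕ → List ℕ → Bool
n ∈ᵇ ns = any (n ≡ᵇ_) ns

∈⇒∈ᵇ : ∀ {n ns} → n ∈ₗ ns → T (n ∈ᵇ ns)
∈⇒∈ᵇ {n} n∈ns = ∈⇒any n∈ns (≡⇒≡ᵇ n n refl)

linesClosedBy : List (Vec ℕ 3) → ℕ → List ℕ → List (Vec ℕ 3)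
linesClosedBy lines p done =
  filterᵇ (λ t → (p ∈ᵇ toList t) ∧ all (_∈ᵇ (p ∷ done)) (toList t)) lines

schedule : List (Vec ℕ 3) → List ℕ → List ℕ → Schedule
schedule lines done []       = []
schedule lines done (p ∷ ps) = (p , linesClosedBy lines p done) ∷ schedule lines (p ∷ done) ps

schedule-LineValuesOn : ∀ {g lines} → All (LineValuesOn g) lines →
                        ∀ done ps → All (All (LineValuesOn g) ∘ proj₂) (schedule lines done ps)
schedule-LineValuesOn lvs done []       = []
schedule-LineValuesOn lvs done (p ∷ ps) = filter⁺ _ lvs ∷ schedule-LineValuesOn lvs (p ∷ done) ps

hasValue : ℕ → Maybe ℕ → Bool
hasValue v (just w) = w ≡ᵇ v
hasValue v nothing  = false

hasValue⇒≡just : ∀ {v m} → T (hasValue v m) → m ≡ just v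
hasValue⇒≡just {v} {just w} t = cong just (≡ᵇ⇒≡ w v t)

completeᵇ : Assignment → Bool
completeᵇ σ = all (is-just ∘ σ) (upTo 63)

attainsᵇ : ℕ → Assignment → Bool
attainsᵇ v σ = any (hasValue v ∘ σ) (upTo 63)

zerosOf : Assignment → List ℕ
zerosOf σ = filterᵇ (hasValue 0 ∘ σ) (upTo 63)

_‼_ : ∀ {A : Set} → List (List A) → ℕ → List A
[]       ‼ _     = []
(x ∷ xs) ‼ zero  = x
(x ∷ xs) ‼ suc n = xs ‼ n

‼-applyUpTo : ∀ {A : Set} (h : ℕ → List A) {n a} → a < n → applyUpTo h n ‼ a ≡ h a
‼-applyUpTo h {suc n} {zero}  _         = refl
‼-applyUpTo h {suc n} {suc a} (s≤s a<n) = ‼-applyUpTo (h ∘ suc) a<n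

linesMeetᵇ : List (Vec ℕ 3) → List (Vec ℕ 3) → Bool
linesMeetᵇ ls ms = any (λ s → any (λ t → any (_∈ᵇ toList t) (toList s)) ms) ls

-- `table ‼ a` lists the lines through a.  The table is an argument, not a top-level
-- constant, so that Agda computes it once per search rather than once per use.
within2ᵇ : List (List (Vec ℕ 3)) → ℕ → ℕ → Bool
within2ᵇ table a b = (a ≡ᵇ b) ∨ linesMeetᵇ (table ‼ a) (table ‼ b)

zerosSpreadᵇ : List (List (Vec ℕ 3)) → List ℕ → Bool
zerosSpreadᵇ table zs = (length zs ≤ᵇ 1) ∨ any (λ a → any (λ b → not (within2ᵇ table a b)) zs) zs

leafᵇ : List (List (Vec ℕ 3)) → Assignment → Bool
leafᵇ table σ = completeᵇ σ ∧ (attainsᵇ 2 σ ∧ zerosSpreadᵇ table (zerosOf σ))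

leafᵇ-split : ∀ table σ → T (leafᵇ table σ) →
              T (completeᵇ σ) × T (attainsᵇ 2 σ) × T (zerosSpreadᵇ table (zerosOf σ))
leafᵇ-split table σ ok =
  let complete , rest = Equivalence.to (T-∧ {completeᵇ σ}) ok
  in complete , Equivalence.to (T-∧ {attainsᵇ 2 σ}) rest

module _ {σ : Assignment} {g : ℕ → ℕ} (σ≼g : σ ≼ g) where

  attainsᵇ-sound : ∀ {v} → T (attainsᵇ v σ) → ∃[ n ] g n ≡ v
  attainsᵇ-sound {v} attains =
    let n , has = Anyₗ.satisfied (any⁻ (hasValue v ∘ σ) (upTo 63) attains)
    in n , σ≼g n (hasValue⇒≡just has)

  zero∈zerosOf : T (completeᵇ σ) → ∀ {n} → n < 63 → g n ≡ 0 → n ∈ₗ zerosOf σ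
  zero∈zerosOf complete {n} n<63 gn≡0 = ∈-filterᵇ⁺ (hasValue 0 ∘ σ) (∈-upTo⁺ n<63) isZero
    where
    isZero : T (hasValue 0 (σ n))
    isZero = subst (T ∘ hasValue 0) (sym (≼-just σ≼g assigned)) (≡⇒≡ᵇ (g n) 0 gn≡0)
      where
      assigned : T (is-just (σ n))
      assigned = All.lookup (all⁺ (is-just ∘ σ) (upTo 63) complete) (∈-upTo⁺ n<63)

  zerosOf⇒zero : ∀ {n} → n ∈ₗ zerosOf σ → n < 63 × g n ≡ 0
  zerosOf⇒zero {n} n∈zs =
    let n∈upTo , isZero = ∈-filterᵇ⁻ (hasValue 0 ∘ σ) n∈zs
    in ∈-upTo⁻ {63} n∈upTo , σ≼g n (hasValue⇒≡just isZero)

  zerosSpreadᵇ-sound : ∀ {table} → T (completeᵇ σ) → T (zerosSpreadᵇ table (zerosOf σ)) →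
                       (∀ {c d} → c < 63 → d < 63 → g c ≡ 0 → g d ≡ 0 → T (within2ᵇ table c d)) →
                       ∀ {a b} → a < 63 → b < 63 → g a ≡ 0 → g b ≡ 0 → a ≡ b
  zerosSpreadᵇ-sound {table} complete spread close {a} {b} a<63 b<63 ga≡0 gb≡0 =
    [ atMostOne , farPair ]′ (Equivalence.to (T-∨ {length zs ≤ᵇ 1}) spread)
    where
    zs : List ℕ
    zs = zerosOf σ
    atMostOne : T (length zs ≤ᵇ 1) → a ≡ b
    atMostOne ≤1 =
      ∈-length≤1 (≤ᵇ⇒≤ _ 1 ≤1) (zero∈zerosOf complete a<63 ga≡0) (zero∈zerosOf complete b<63 gb≡0)
    farPair : T (any (λ c → any (λ d → not (within2ᵇ table c d)) zs) zs) → a ≡ b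
    farPair far =
      let c , c∈zs , c-far  = find (any⁻ (λ c → any (λ d → not (within2ᵇ table c d)) zs) zs far)
          d , d∈zs , cd-far = find (any⁻ (λ d → not (within2ᵇ table c d)) zs c-far)
          c<63 , gc≡0 = zerosOf⇒zero c∈zs
          d<63 , gd≡0 = zerosOf⇒zero d∈zs
      in ⊥-elim (subst T (Equivalence.to T-not-≡ cd-far) (close c<63 d<63 gc≡0 gd≡0))

hd2Lines : List (Vec ℕ 3)
hd2Lines = List.tabulate (lookup hd2Table)

∈-hd2Lines : ∀ l → lookup hd2Table l ∈ₗ hd2Lines
∈-hd2Lines = ∈-tabulate⁺ {f = lookup hd2Table}

ProperLine : Vec ℕ 3 → Set
ProperLine (a ∷ b ∷ c ∷ []) = (a < 63 × b < 63 × c < 63) × (a ≢ b × a ≢ c × b ≢ c)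

properLine? : ∀ t → Dec (ProperLine t)
properLine? (a ∷ b ∷ c ∷ []) =
  ((a <? 63) ×-dec (b <? 63) ×-dec (c <? 63)) ×-dec (¬? (a ≟ b) ×-dec ¬? (a ≟ c) ×-dec ¬? (b ≟ c))

hd2Lines-proper : All ProperLine hd2Lines
hd2Lines-proper = from-yes (all? properLine? hd2Lines)

toℕ-mod-< : ∀ {m n} .{{_ : NonZero n}} → m < n → toℕ (m mod n) ≡ m
toℕ-mod-< m<n = trans (toℕ-fromℕ< _) (m<n⇒m%n≡m m<n)

toℕ-mod : ∀ {n} .{{_ : NonZero n}} (i : Fin n) → toℕ i mod n ≡ i
toℕ-mod i = toℕ-injective (toℕ-mod-< (toℕ<n i))

-- `_mod 63` inverts toℕ on indices, so f ∘ (_mod 63) is f read on indices.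
module _ (f : HPoint → ℕ) where

  centre⇒LineValuesOn : ∀ {t} → ProperLine t → ∀ c → toℕ c ∈ t →
                        (∀ q → toℕ q ∈ t → q ≢ c → f q ≡ suc (f c)) →
                        LineValuesOn (f ∘ (_mod 63)) t
  centre⇒LineValuesOn {a ∷ b ∷ c ∷ []} ((a< , b< , c<) , a≢b , a≢c , b≢c) p p∈t above =
    centre⇒LineValues f (mod-≢ a< b< a≢b) (mod-≢ a< c< a≢c) (mod-≢ b< c< b≢c)
                      (from∈ p∈t) (λ q∈ → above _ (to∈ q∈))
    where
    mod-≢ : ∀ {x y} → x < 63 → y < 63 → x ≢ y → x mod 63 ≢ y mod 63
    mod-≢ x< y< x≢y e = x≢y (trans (sym (toℕ-mod-< x<)) (trans (cong toℕ e) (toℕ-mod-< y<)))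
    toℕ≡⇒≡mod : ∀ {x} → toℕ p ≡ x → p ≡ x mod 63
    toℕ≡⇒≡mod e = trans (sym (toℕ-mod p)) (cong (_mod 63) e)
    from∈ : toℕ p ∈ a ∷ b ∷ c ∷ [] → p ∈ a mod 63 ∷ b mod 63 ∷ c mod 63 ∷ []
    from∈ (here e)                 = here (toℕ≡⇒≡mod e)
    from∈ (there (here e))         = there (here (toℕ≡⇒≡mod e))
    from∈ (there (there (here e))) = there (there (here (toℕ≡⇒≡mod e)))
    to∈ : ∀ {q} → q ∈ a mod 63 ∷ b mod 63 ∷ c mod 63 ∷ [] → toℕ q ∈ a ∷ b ∷ c ∷ []
    to∈ (here refl)                 = here (toℕ-mod-< a<)
    to∈ (there (here refl))         = there (here (toℕ-mod-< b<))
    to∈ (there (there (here refl))) = there (there (here (toℕ-mod-< c<)))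

  valuation⇒LineValuesOn : IsValuation f → All (LineValuesOn (f ∘ (_mod 63))) hd2Lines
  valuation⇒LineValuesOn (_ , _ , centres) = tabulate⁺ {f = lookup hd2Table} λ l →
    let c , c∈l , above = centres l in
    centre⇒LineValuesOn (All.lookup hd2Lines-proper (∈-hd2Lines l)) c c∈l above

linesThrough : ℕ → List (Vec ℕ 3)
linesThrough p = filterᵇ (λ t → p ∈ᵇ toList t) hd2Lines

linesThroughTable : List (List (Vec ℕ 3))
linesThroughTable = applyUpTo linesThrough 63

onH⇒∈ᵇ : ∀ {p} l → p onH l → T (toℕ p ∈ᵇ toList (lookup hd2Table l))
onH⇒∈ᵇ l = ∈⇒∈ᵇ ∘ ∈-toList⁺

onH⇒∈linesThrough : ∀ {p} l → p onH l → lookup hd2Table l ∈ₗ linesThroughTable ‼ toℕ p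
onH⇒∈linesThrough {p} l p∈l rewrite ‼-applyUpTo linesThrough (toℕ<n p) =
  ∈-filterᵇ⁺ (λ t → toℕ p ∈ᵇ toList t) (∈-hd2Lines l) (onH⇒∈ᵇ l p∈l)

meet⇒within2ᵇ : ∀ {a b c} l m → a onH l → c onH l → c onH m → b onH m →
                T (within2ᵇ linesThroughTable (toℕ a) (toℕ b))
meet⇒within2ᵇ l m a∈l c∈l c∈m b∈m = Equivalence.from T-∨ (inj₂
  (∈⇒any (onH⇒∈linesThrough l a∈l)
    (∈⇒any (onH⇒∈linesThrough m b∈m) (∈⇒any (∈-toList⁺ c∈l) (onH⇒∈ᵇ m c∈m)))))

walk≤2⇒within2ᵇ : ∀ {a b} → WalkH a b 2 → T (within2ᵇ linesThroughTable (toℕ a) (toℕ b))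
walk≤2⇒within2ᵇ {a} here = Equivalence.from T-∨ (inj₁ (≡⇒≡ᵇ (toℕ a) _ refl))
walk≤2⇒within2ᵇ (step (_ , l , a∈l , b∈l) here) = meet⇒within2ᵇ l l a∈l b∈l b∈l b∈l
walk≤2⇒within2ᵇ (step (_ , l , a∈l , c∈l) (step (_ , m , c∈m , b∈m) here)) =
  meet⇒within2ᵇ l m a∈l c∈l c∈m b∈m

-- Any order is sound; this one closes lines early, so the search prunes quickly.
searchOrder : List ℕ
searchOrder =
  0 ∷ 1 ∷ 2 ∷ 4 ∷ 7 ∷ 3 ∷ 5 ∷ 6 ∷ 8 ∷ 9 ∷ 15 ∷ 10 ∷ 11 ∷ 12 ∷ 18 ∷ 13 ∷
  14 ∷ 17 ∷ 16 ∷ 19 ∷ 20 ∷ 21 ∷ 22 ∷ 27 ∷ 33 ∷ 28 ∷ 34 ∷ 25 ∷ 26 ∷ 31 ∷ 32 ∷ 37 ∷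
  38 ∷ 39 ∷ 40 ∷ 50 ∷ 49 ∷ 61 ∷ 62 ∷ 42 ∷ 35 ∷ 36 ∷ 59 ∷ 41 ∷ 60 ∷ 55 ∷ 56 ∷ 23 ∷
  24 ∷ 44 ∷ 43 ∷ 30 ∷ 29 ∷ 45 ∷ 51 ∷ 46 ∷ 54 ∷ 53 ∷ 47 ∷ 48 ∷ 52 ∷ 57 ∷ 58 ∷ []

-- Stated with ≡ rather than T: Agda evaluates it much faster in a conversion check.
hd2-search : search (0 ∷ 1 ∷ 2 ∷ []) (leafᵇ linesThroughTable) (schedule hd2Lines [] searchOrder)
                    unassigned ≡ true
hd2-search = refl

≤2⇒∈0∷1∷2 : ∀ {n} → n ≤ 2 → n ∈ₗ 0 ∷ 1 ∷ 2 ∷ []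
≤2⇒∈0∷1∷2 z≤n             = Anyₗ.here refl
≤2⇒∈0∷1∷2 (s≤s z≤n)       = Anyₗ.there (Anyₗ.here refl)
≤2⇒∈0∷1∷2 (s≤s (s≤s z≤n)) = Anyₗ.there (Anyₗ.there (Anyₗ.here refl))

module _ {f : HPoint → ℕ} (f-valuation : IsValuation f) (f≤2 : ∀ p → f p ≤ 2) where

  private
    reached : ∃[ σ ] (σ ≼ f ∘ (_mod 63) × T (leafᵇ linesThroughTable σ))
    reached =
      search-sound (0 ∷ 1 ∷ 2 ∷ []) (leafᵇ linesThroughTable) (λ n → ≤2⇒∈0∷1∷2 (f≤2 (n mod 63)))
                   (schedule hd2Lines [] searchOrder) {unassigned} unassigned-≼
                   (schedule-LineValuesOn (valuation⇒LineValuesOn f f-valuation) [] searchOrder)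
                   hd2-search

  valuation≤2-attains2 : Σ[ p ∈ HPoint ] f p ≡ 2
  valuation≤2-attains2 =
    let σ , σ≼f , ok = reached
        _ , attains2 , _ = leafᵇ-split linesThroughTable σ ok
        n , fn≡2 = attainsᵇ-sound σ≼f attains2
    in n mod 63 , fn≡2

  valuation≤2-zero-unique : (∀ a b → f a ≡ 0 → f b ≡ 0 → WalkH a b 2) →
                            ∀ {a b} → f a ≡ 0 → f b ≡ 0 → a ≡ b
  valuation≤2-zero-unique close {a} {b} fa≡0 fb≡0 =
    let σ , σ≼f , ok = reached
        complete , _ , spread = leafᵇ-split linesThroughTable σ ok
    in toℕ-injective (zerosSpreadᵇ-sound σ≼f {linesThroughTable} complete spread close′
                                          (toℕ<n a) (toℕ<n b) (onℕ fa≡0) (onℕ fb≡0))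
    where
    onℕ : ∀ {p} → f p ≡ 0 → f (toℕ p mod 63) ≡ 0
    onℕ {p} fp≡0 = trans (cong f (toℕ-mod p)) fp≡0
    close′ : ∀ {c d} → c < 63 → d < 63 → f (c mod 63) ≡ 0 → f (d mod 63) ≡ 0 →
             T (within2ᵇ linesThroughTable c d)
    close′ c<63 d<63 fc≡0 fd≡0 =
      subst₂ (λ x y → T (within2ᵇ linesThroughTable x y)) (toℕ-mod-< c<63) (toℕ-mod-< d<63)
             (walk≤2⇒within2ᵇ (close _ _ fc≡0 fd≡0))

minFin-≤ : ∀ {n} (h : Fin (suc n) → ℕ) i → minFin h ≤ h i
minFin-≤ {zero}  h zero    = ≤-refl
minFin-≤ {suc n} h zero    = m⊓n≤m (h zero) _
minFin-≤ {suc n} h (suc i) = ≤-trans (m⊓n≤n (h zero) _) (minFin-≤ (h ∘ suc) i)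

minFin-attained : ∀ {n} (h : Fin (suc n) → ℕ) → ∃[ i ] h i ≡ minFin h
minFin-attained {zero}  h = zero , refl
minFin-attained {suc n} h with ⊓-sel (h zero) (minFin (h ∘ suc))
... | inj₁ h₀≡min = zero , sym h₀≡min
... | inj₂ rest≡min = let i , hᵢ≡ = minFin-attained (h ∘ suc) in suc i , trans hᵢ≡ (sym rest≡min)

walk-snoc : ∀ {P : Set} {adj : P → P → Set} {x y z n} →
            Walk adj x y n → adj y z → Walk adj x z (suc n)
walk-snoc here        yz = step yz here
walk-snoc (step xw w) yz = step xw (walk-snoc w yz)

module _ (N : NearHexagon) (H : HD2Sub N) where
  open NearHexagon N
  open HD2Sub H

  walk⇒d≤ : ∀ {x y n} → Walk Collinear x y n → d x y ≤ n
  walk⇒d≤ {x} {y} {n} = Equivalence.from (d-spec x y n)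

  geodesic : ∀ x y → Walk Collinear x y (d x y)
  geodesic x y = Equivalence.to (d-spec x y (d x y)) ≤-refl

  distToH-≤ : ∀ x p → distToH N H x ≤ d x (ι p)
  distToH-≤ x = minFin-≤ (λ p → d x (ι p))

  distToH-attained : ∀ x → ∃[ p ] d x (ι p) ≡ distToH N H x
  distToH-attained x = minFin-attained (λ p → d x (ι p))

  distToH-ι : ∀ p → distToH N H (ι p) ≡ 0
  distToH-ι p = n≤0⇒n≡0 (≤-trans (distToH-≤ (ι p) p) (walk⇒d≤ here))

  fval-≤ : ∀ x p → fval N H x p ≤ 3 ∸ distToH N H x
  fval-≤ x p = ∸-monoˡ-≤ (distToH N H x) (diam-≤3 x (ι p))

  fval-ι : ∀ p q → fval N H (ι p) q ≡ d (ι p) (ι q)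
  fval-ι p q = cong (d (ι p) (ι q) ∸_) (distToH-ι p)

  module _ (full : Full N H) where

    nearest-on-line : ∀ x l → Σ[ p ∈ HPoint ]
                        (p onH l × (∀ q → q onH l → q ≢ p → d x (ι q) ≡ suc (d x (ι p))))
    nearest-on-line x l with nearest x (ιL l)
    ... | z , z∈L , z-nearest with full l z z∈L
    ... | p , refl = p , Equivalence.from (incidence p l) z∈L , one-further
      where
      one-further : ∀ q → q onH l → q ≢ p → d x (ι q) ≡ suc (d x (ι p))
      one-further q q∈l q≢p = ≤-antisym
        (walk⇒d≤ (walk-snoc (geodesic x (ι p)) (ιp≢ιq , ιL l , z∈L , ιq∈L)))
        (z-nearest (ι q) ιq∈L (≢-sym ιp≢ιq))
        where
        ιq∈L : ι q on ιL l
        ιq∈L = Equivalence.to (incidence q l) q∈l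
        ιp≢ιq : ι p ≢ ι q
        ιp≢ιq ιp≡ιq = q≢p (ι-inj (sym ιp≡ιq))

    fval-valuation : ∀ x → IsValuation (fval N H x)
    fval-valuation x =
      let p₀ , dp₀≡dist = distToH-attained x in
      p₀ , trans (cong (_∸ distToH N H x) dp₀≡dist) (n∸n≡0 (distToH N H x)) , centre
      where
      centre : ∀ l → Σ[ p ∈ HPoint ]
                 (p onH l × (∀ q → q onH l → q ≢ p → fval N H x q ≡ suc (fval N H x p)))
      centre l =
        let p , p∈l , one-further = nearest-on-line x l in
        p , p∈l , λ q q∈l q≢p →
          trans (cong (_∸ distToH N H x) (one-further q q∈l q≢p)) (+-∸-assoc 1 (distToH-≤ x p))

    distToH≤1 : ∀ x → distToH N H x ≤ 1
    distToH≤1 x with 2 ≤? distToH N H x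
    ... | no  dist≱2 = ≤-pred (≰⇒> dist≱2)
    ... | yes 2≤dist =
      let p , fp≡2 = valuation≤2-attains2 (fval-valuation x) (λ p → ≤-trans (f≤1 p) (n≤1+n 1))
      in ⊥-elim (1+n≰n (subst (_≤ 1) fp≡2 (f≤1 p)))
      where
      f≤1 : ∀ p → fval N H x p ≤ 1
      f≤1 p = ≤-trans (fval-≤ x p) (∸-monoʳ-≤ 3 2≤dist)

  fval-ι-classical : Isometric N H → ∀ p → Classical (fval N H (ι p)) p
  fval-ι-classical iso p q n = mk⇔
    (λ f≤n → Equivalence.to (iso p q n) (subst (_≤ n) (fval-ι p q) f≤n))
    (λ walk → subst (_≤ n) (sym (fval-ι p q)) (Equivalence.from (iso p q n) walk))

  module AtDistance1 (full : Full N H) (iso : Isometric N H)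
                     (y : Point) (y-dist : distToH N H y ≡ 1) where

    fval≤2 : ∀ q → fval N H y q ≤ 2
    fval≤2 q = subst (λ m → fval N H y q ≤ 3 ∸ m) y-dist (fval-≤ y q)

    fval≡0⇔collinear : ∀ q → fval N H y q ≡ 0 ⇔ Collinear y (ι q)
    fval≡0⇔collinear q = mk⇔ to from
      where
      fval≡d∸1 : fval N H y q ≡ d y (ι q) ∸ 1
      fval≡d∸1 = cong (d y (ι q) ∸_) y-dist
      to : fval N H y q ≡ 0 → Collinear y (ι q)
      to f≡0 with Equivalence.to (d-spec y (ι q) 1) (m∸n≡0⇒m≤n (trans (sym fval≡d∸1) f≡0))
      ... | here         = ⊥-elim (0≢1+n (trans (sym (distToH-ι q)) y-dist))
      ... | step yq here = yq
      from : Collinear y (ι q) → fval N H y q ≡ 0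
      from yq = trans fval≡d∸1 (m≤n⇒m∸n≡0 (walk⇒d≤ (step yq here)))

    zeros-within2 : ∀ a b → fval N H y a ≡ 0 → fval N H y b ≡ 0 → WalkH a b 2
    zeros-within2 a b fa≡0 fb≡0 =
      let ya = Equivalence.to (fval≡0⇔collinear a) fa≡0
          yb = Equivalence.to (fval≡0⇔collinear b) fb≡0
      in Equivalence.to (iso a b 2) (walk⇒d≤ (step (collinear-sym ya) (step yb here)))
      where
      collinear-sym : ∀ {u v} → Collinear u v → Collinear v u
      collinear-sym (u≢v , L , u∈L , v∈L) = ≢-sym u≢v , L , v∈L , u∈L

    zero-unique : ∀ {a b} → fval N H y a ≡ 0 → fval N H y b ≡ 0 → a ≡ b
    zero-unique = valuation≤2-zero-unique (fval-valuation full y) fval≤2 zeros-within2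

    foot : HPoint
    foot = proj₁ (distToH-attained y)

    foot-zero : fval N H y foot ≡ 0
    foot-zero = trans (cong (_∸ distToH N H y) (proj₂ (distToH-attained y))) (n∸n≡0 (distToH N H y))

    zeroSet : ZeroSetIs (fval N H y) foot
    zeroSet q = mk⇔ (λ fq≡0 → zero-unique fq≡0 foot-zero) (λ { refl → foot-zero })

    typeC : TypeC (fval N H y)
    typeC = fval-valuation full y
          , (fval≤2 , valuation≤2-attains2 (fval-valuation full y) fval≤2)
          , foot , zeroSet

    foot-collinear : Collinear y (ι foot)
    foot-collinear = Equivalence.to (fval≡0⇔collinear foot) foot-zero

    collinear⇒foot : ∀ q → Collinear y (ι q) → q ≡ foot
    collinear⇒foot q yq = zero-unique (Equivalence.from (fval≡0⇔collinear q) yq) foot-zero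

lemma3p3 : (N : NearHexagon) → ThreePointsPerLine N →
           (H : HD2Sub N) → Full N H → Proper N H → Isometric N H →
           -- (1) every point has distance at most 1 from H
           (∀ x → distToH N H x ≤ 1)
           -- (2) points of H have Type A, f_x classical with center x
           × (∀ p → TypeA (fval N H (HD2Sub.ι H p))
                    × Classical (fval N H (HD2Sub.ι H p)) p)
           -- (3) points at distance 1 from H
           × (∀ y → distToH N H y ≡ 1 →
                TypeC (fval N H y)
                × Σ[ y' ∈ HPoint ]
                    ( NearHexagon.Collinear N y (HD2Sub.ι H y')
                    × (∀ q → NearHexagon.Collinear N y (HD2Sub.ι H q) → q ≡ y')
                    × ZeroSetIs (fval N H y) y'))
lemma3p3 N _ H full _ iso =
    distToH≤1 N H full
  , (λ p → (p , fval-ι-classical N H iso p) , fval-ι-classical N H iso p)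
  , λ y y-dist → let open AtDistance1 N H full iso y y-dist in
                 typeC , foot , foot-collinear , collinear⇒foot , zeroSet
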